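{- Consider an asymmetric $(k,t)$ scale on a finite totally ordered set $X$ (distinct elements, order unknown), i.e. $2t \ne k+1$. Let $z_1,\ldots,z_{k+1}$ be $k+1$ fixed elements of $X$. By querying all $\binom{k+1}{k}$ $k$-subsets of $\{z_1,\dots,z_{k+1}\}$ one can find two of them, $x$ and $y$, such that neither $x$ nor $y$ lies in $S\cup L$, and one knows that $x<y$.
   Context: A $(k,t)$ scale accepts as input any $k$-element subset of $X$ and returns its $t$-th smallest element; applying it to a subset is a query. $S$ is the set of the $t-1$ smallest elements of $X$ and $L$ the set of the $k-t$ largest elements of $X$. -}

module Defs where

open import Data.Nat using (ℕ; suc; _<_; _≤_; _∸_)
open import Data.Nat.Properties using (_<?_)
open import Data.Fin using (Fin; _≟_)
open import Data.List using (length; filter; allFin)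
open import Relation.Nullary.Decidable using (¬?; _×-dec_)

-- The unknown total order on X = Fin n is given by an injective
-- "rank" function r : Fin n → ℕ (x precedes y iff r x < r y).

below : ∀ {n} → (Fin n → ℕ) → Fin n → ℕ
below {n} r x = length (filter (λ y → r y <? r x) (allFin n))

above : ∀ {n} → (Fin n → ℕ) → Fin n → ℕ
above {n} r x = length (filter (λ y → r x <? r y) (allFin n))

InS : ∀ {n} → (Fin n → ℕ) → ℕ → Fin n → Set
InS r t x = below r x < t ∸ 1

InL : ∀ {n} → (Fin n → ℕ) → ℕ → ℕ → Fin n → Set
InL r k t x = above r x < k ∸ t

-- The query to the k-subset {z_l | l ≠ i} of Z = {z_0,...,z_k}.
-- Number of elements of that subset strictly smaller than z_j:
rankInQuery : ∀ {n k} → (Fin n → ℕ) → (Fin (suc k) → Fin n) →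
              Fin (suc k) → Fin (suc k) → ℕ
rankInQuery {k = k} r z i j =
  length (filter (λ l → ¬? (l ≟ i) ×-dec (r (z l) <? r (z j))) (allFin (suc k)))

-- a is the (complete) list of answers of the (k,t) scale to all k+1 queries:
-- a i is (the index in Z of) the t-th smallest element of Z ∖ {z_i}.
IsAnswers : ∀ {n k} → (Fin n → ℕ) → (Fin (suc k) → Fin n) → ℕ →
            (Fin (suc k) → Fin (suc k)) → Set
IsAnswers r z t a = ∀ i → (a i ≢ i) × (rankInQuery r z i (a i) ≡ t ∸ 1)
  where
  open import Data.Product using (_×_)
  open import Relation.Binary.PropositionalEquality using (_≡_; _≢_)

-- Let x and y be the t-th and (t+1)-th smallest elements of Z = {z_0, …, z_k}.
-- The query omitting z_i returns y when z_i is among the t smallest elements of Z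
-- and x otherwise, so every answer is x or y, y is returned exactly t times and x
-- exactly k + 1 − t times. The answer c to the first query is therefore x or y, and
-- the answer to the query omitting c is the other one; since t ≠ k + 1 − t, counting
-- how often c was returned tells which is which. Finally x and y already have t − 1
-- elements below and k − t elements above them inside Z, so neither lies in S ∪ L.
module Submission where

open import Defs

open import Level using (Level)
open import Data.Fin as Fin using (Fin; zero)
open import Data.List using (List; []; _∷_; length; filter; map; allFin)
open import Data.List.Properties using (filter-notAll; length-map; length-tabulate)
open import Data.List.Membership.Propositional using (_∈_)
open import Data.List.Membership.Propositional.Properties
  using (∈-filter⁺; ∈-filter⁻; ∈-map⁻; ∈-allFin)
open import Data.List.Relation.Unary.All as All using (All; []; _∷_)
open import Data.List.Relation.Unary.Any as Any using (here; there)
open import Data.List.Relation.Unary.AllPairs using (_∷_)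
open import Data.List.Relation.Unary.Unique.Propositional using (Unique)
import Data.List.Relation.Unary.Unique.Propositional.Properties as Unique
import Data.List.Relation.Binary.Sublist.Propositional as Sublist
import Data.List.Relation.Binary.Sublist.Propositional.Properties as Sublist
open import Data.Nat using (ℕ; suc; _+_; _*_; _∸_; _≤_; _<_; z≤n; s≤s)
import Data.Nat as ℕ
open import Data.Nat.Properties
  using ( _<?_; +-suc; +-comm; +-identityʳ; suc-injective; 1+n≢n; n≤1+n; n<1+n
        ; ≤-reflexive; ≤-trans; <-trans; <-≤-trans; <-irrefl; <-asym; <-cmp; <⇒≢; <⇒≱
        ; ≮⇒≥; ≤∧≢⇒<; m<1+n⇒m≤n; ∸-monoʳ-≤; m+n∸m≡n; module ≤-Reasoning)
open import Data.Product using (Σ; _×_; _,_; proj₁; proj₂)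
open import Data.Sum using (_⊎_; inj₁; inj₂)
open import Function using (id)
open import Function.Bundles using (_⇔_; mk⇔; Equivalence)
open import Function.Definitions using (Injective)
open import Relation.Binary.Definitions using (DecidableEquality; tri<; tri≈; tri>)
open import Relation.Binary.PropositionalEquality
  using (_≡_; _≢_; refl; sym; trans; cong; cong₂; subst; subst₂; ≢-sym; module ≡-Reasoning)
open import Relation.Nullary using (¬_; yes; no; contradiction)
open import Relation.Nullary.Decidable using (¬?; _×-dec_)
open import Relation.Unary using (Pred; Decidable; _⊆_)
open import Relation.Unary.Properties using (∁?)

private variable
  A : Set
  p q : Level

count : {P : Pred A p} → Decidable P → List A → ℕ
count P? xs = length (filter P? xs)

module _ {P : Pred A p} {Q : Pred A q} (P? : Decidable P) (Q? : Decidable Q) where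

  count-mono : P ⊆ Q → ∀ xs → count P? xs ≤ count Q? xs
  count-mono P⊆Q xs =
    Sublist.length-mono-≤ (Sublist.filter⁺ P? Q? (λ { refl → P⊆Q }) (Sublist.⊆-refl {x = xs}))

  count-cong : ∀ {xs} → All (λ x → P x ⇔ Q x) xs → count P? xs ≡ count Q? xs
  count-cong {[]}     []            = refl
  count-cong {x ∷ xs} (P⇔Q ∷ P⇔Qs) with P? x | Q? x
  ... | yes _  | yes _  = cong suc (count-cong P⇔Qs)
  ... | no  _  | no  _  = count-cong P⇔Qs
  ... | yes px | no ¬qx = contradiction (Equivalence.to P⇔Q px) ¬qx
  ... | no ¬px | yes qx = contradiction (Equivalence.from P⇔Q qx) ¬px

count+count-∁ : {P : Pred A p} (P? : Decidable P) → ∀ xs → count P? xs + count (∁? P?) xs ≡ length xs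
count+count-∁ P? []       = refl
count+count-∁ P? (x ∷ xs) with P? x
... | yes _ = cong suc (count+count-∁ P? xs)
... | no  _ = trans (+-suc _ _) (cong suc (count+count-∁ P? xs))

module _ (_≟_ : DecidableEquality A) {P : Pred A p} (P? : Decidable P) where

  except? : ∀ i → Decidable (λ l → ¬ l ≡ i × P l)
  except? i l = ¬? (l ≟ i) ×-dec P? l

  count-except-¬P : ∀ {i} → ¬ P i → ∀ xs → count (except? i) xs ≡ count P? xs
  count-except-¬P ¬Pi xs = count-cong (except? _) P? (All.universal (λ _ → except⇔P) xs)
    where
    except⇔P : ∀ {l} → (¬ l ≡ _ × P l) ⇔ P l
    except⇔P = mk⇔ proj₂ (λ Pl → (λ { refl → ¬Pi Pl }) , Pl)

  count-except-P : ∀ {i xs} → Unique xs → i ∈ xs → P i → suc (count (except? i) xs) ≡ count P? xs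
  count-except-P {xs = x ∷ xs} (x∉xs ∷ _) (here refl) Px with x ≟ x | P? x
  ... | no x≢x | _      = contradiction refl x≢x
  ... | yes _  | no ¬Px = contradiction Px ¬Px
  ... | yes _  | yes _  = cong suc (count-cong (except? x) P? (All.map except⇔P x∉xs))
    where
    except⇔P : ∀ {l} → x ≢ l → (¬ l ≡ x × P l) ⇔ P l
    except⇔P x≢l = mk⇔ proj₂ (λ Pl → (λ l≡x → x≢l (sym l≡x)) , Pl)
  count-except-P {i} {x ∷ xs} (x∉xs ∷ u) (there i∈xs) Pi with x ≟ i | P? x
  ... | yes refl | _     = contradiction refl (All.lookup x∉xs i∈xs)
  ... | no _     | yes _ = cong suc (count-except-P u i∈xs Pi)
  ... | no _     | no _  = count-except-P u i∈xs Pi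

count-mono-< : (_≟_ : DecidableEquality A) {P : Pred A p} {Q : Pred A q}
               (P? : Decidable P) (Q? : Decidable Q) → P ⊆ Q →
               ∀ {y xs} → Unique xs → y ∈ xs → ¬ P y → Q y → count P? xs < count Q? xs
count-mono-< _≟_ {P} {Q} P? Q? P⊆Q {y} {xs} u y∈xs ¬Py Qy = begin-strict
  count P? xs                  ≤⟨ count-mono P? (except? _≟_ Q? y) P⊆except xs ⟩
  count (except? _≟_ Q? y) xs  <⟨ ≤-reflexive (count-except-P _≟_ Q? u y∈xs Qy) ⟩
  count Q? xs                  ∎
  where
  open ≤-Reasoning
  P⊆except : P ⊆ (λ l → ¬ l ≡ y × Q l)
  P⊆except Pl = (λ { refl → ¬Py Pl }) , P⊆Q Pl

Unique-⊆⇒length-≤ : DecidableEquality A → ∀ {xs ys : List A} → Unique xs →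
                    (∀ {x} → x ∈ xs → x ∈ ys) → length xs ≤ length ys
Unique-⊆⇒length-≤ _≟_ {[]}         _          _     = z≤n
Unique-⊆⇒length-≤ _≟_ {x ∷ xs} {ys} (x∉xs ∷ u) xs⊆ys = begin-strict
  length xs               ≤⟨ Unique-⊆⇒length-≤ _≟_ u xs⊆ys-x ⟩
  length (filter ≢x? ys)  <⟨ filter-notAll ≢x? ys (Any.map (λ { refl x≢x → x≢x refl }) x∈ys) ⟩
  length ys               ∎
  where
  open ≤-Reasoning
  ≢x? : Decidable (λ y → ¬ y ≡ x)
  ≢x? y = ¬? (y ≟ x)
  x∈ys : x ∈ ys
  x∈ys = xs⊆ys (here refl)
  xs⊆ys-x : ∀ {y} → y ∈ xs → y ∈ filter ≢x? ys
  xs⊆ys-x y∈xs = ∈-filter⁺ ≢x? (xs⊆ys (there y∈xs)) (λ { refl → All.lookup x∉xs y∈xs refl })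

count-∘-injective : ∀ {m n} {P : Pred (Fin n) p} (P? : Decidable P) (f : Fin m → Fin n) →
                    Injective _≡_ _≡_ f → count (λ l → P? (f l)) (allFin m) ≤ count P? (allFin n)
count-∘-injective {m = m} {n} {P} P? f f-injective = begin
  length (filter P∘f? (allFin m))          ≡⟨ length-map f (filter P∘f? (allFin m)) ⟨
  length (map f (filter P∘f? (allFin m)))  ≤⟨ Unique-⊆⇒length-≤ Fin._≟_ unique image⊆ ⟩
  length (filter P? (allFin n))            ∎
  where
  open ≤-Reasoning
  P∘f? : Decidable (λ l → P (f l))
  P∘f? l = P? (f l)
  unique : Unique (map f (filter P∘f? (allFin m)))
  unique = Unique.map⁺ f-injective (Unique.filter⁺ P∘f? (Unique.allFin⁺ m))
  image⊆ : ∀ {y} → y ∈ map f (filter P∘f? (allFin m)) → y ∈ filter P? (allFin n)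
  image⊆ y∈ with ∈-map⁻ f y∈
  ... | l , l∈ , refl = ∈-filter⁺ P? (∈-allFin (f l)) (proj₂ (∈-filter⁻ P∘f? {xs = allFin m} l∈))

module Rank {m} (v : Fin m → ℕ) (v-injective : Injective _≡_ _≡_ v) where

  rank corank : Fin m → ℕ
  rank   j = count (λ l → v l <? v j) (allFin m)
  corank j = count (λ l → v j <? v l) (allFin m)

  rank-mono-< : ∀ {i j} → v i < v j → rank i < rank j
  rank-mono-< {i} {j} vi<vj = count-mono-< Fin._≟_ (λ l → v l <? v i) (λ l → v l <? v j)
    (λ vl<vi → <-trans vl<vi vi<vj) (Unique.allFin⁺ m) (∈-allFin i) (<-irrefl refl) vi<vj

  rank-cancel-< : ∀ {i j} → rank i < rank j → v i < v j
  rank-cancel-< {i} {j} ri<rj with <-cmp (v i) (v j)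
  ... | tri< vi<vj _ _ = vi<vj
  ... | tri≈ _ vi≡vj _ = contradiction ri<rj (<-irrefl (cong rank (v-injective vi≡vj)))
  ... | tri> _ _ vj<vi = contradiction ri<rj (<-asym (rank-mono-< vj<vi))

  rank-injective : ∀ {i j} → rank i ≡ rank j → i ≡ j
  rank-injective {i} {j} ri≡rj with <-cmp (v i) (v j)
  ... | tri< vi<vj _ _ = contradiction ri≡rj (<⇒≢ (rank-mono-< vi<vj))
  ... | tri≈ _ vi≡vj _ = v-injective vi≡vj
  ... | tri> _ _ vj<vi = contradiction ri≡rj (≢-sym (<⇒≢ (rank-mono-< vj<vi)))

  rank+corank : ∀ j → rank j + suc (corank j) ≡ m
  rank+corank j = begin
    rank j + suc (corank j)                 ≡⟨ cong (λ c → rank j + suc c) corank≡ ⟩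
    rank j + suc (count ≢j∧≮j? (allFin m))  ≡⟨ cong (rank j +_) remove-j ⟩
    rank j + count ≮j? (allFin m)           ≡⟨ count+count-∁ (λ l → v l <? v j) (allFin m) ⟩
    length (allFin m)                       ≡⟨ length-tabulate id ⟩
    m                                       ∎
    where
    open ≡-Reasoning
    ≮j? : Decidable (λ l → ¬ v l < v j)
    ≮j? = ∁? (λ l → v l <? v j)
    ≢j∧≮j? : Decidable (λ l → ¬ l ≡ j × ¬ v l < v j)
    ≢j∧≮j? = except? Fin._≟_ ≮j? j
    above⇔ : ∀ {l} → v j < v l ⇔ (¬ l ≡ j × ¬ v l < v j)
    above⇔ = mk⇔ (λ vj<vl → (λ { refl → <-irrefl refl vj<vl }) , <-asym vj<vl)
                 (λ (l≢j , vl≮vj) → ≤∧≢⇒< (≮⇒≥ vl≮vj) (λ vj≡vl → l≢j (v-injective (sym vj≡vl))))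
    corank≡ : corank j ≡ count ≢j∧≮j? (allFin m)
    corank≡ = count-cong (λ l → v j <? v l) ≢j∧≮j? (All.universal (λ _ → above⇔) (allFin m))
    remove-j : suc (count ≢j∧≮j? (allFin m)) ≡ count ≮j? (allFin m)
    remove-j = count-except-P Fin._≟_ ≮j? (Unique.allFin⁺ m) (∈-allFin j) (<-irrefl refl)

multiplicity : ∀ {m} → (Fin m → Fin m) → Fin m → ℕ
multiplicity {m} a j = count (λ i → a i Fin.≟ j) (allFin m)

orderedPair : ∀ {k} → ℕ → (Fin (suc k) → Fin (suc k)) → Fin (suc k) × Fin (suc k)
orderedPair t a with multiplicity a (a zero) ℕ.≟ t
... | yes _ = a (a zero) , a zero
... | no  _ = a zero , a (a zero)

module Scale {n k} (r : Fin n → ℕ) (r-injective : Injective _≡_ _≡_ r)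
             (z : Fin (suc k) → Fin n) (z-injective : Injective _≡_ _≡_ z) where

  r∘z-injective : Injective _≡_ _≡_ (λ l → r (z l))
  r∘z-injective e = z-injective (r-injective e)

  open Rank (λ l → r (z l)) r∘z-injective public

  rank≤below : ∀ j → rank j ≤ below r (z j)
  rank≤below j = count-∘-injective (λ y → r y <? r (z j)) z z-injective

  corank≤above : ∀ j → corank j ≤ above r (z j)
  corank≤above j = count-∘-injective (λ y → r (z j) <? r y) z z-injective

  rank-between⇒∉S∪L : ∀ {t j} → t ≤ rank j → rank j ≤ suc t →
                      ¬ InS r (suc t) (z j) × ¬ InL r k (suc t) (z j)
  rank-between⇒∉S∪L {t} {j} t≤rank rank≤1+t =
      (λ below<t → <-irrefl refl (<-≤-trans below<t (≤-trans t≤rank (rank≤below j))))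
    , (λ above<k-t → <-irrefl refl (<-≤-trans above<k-t (≤-trans k-t≤corank (corank≤above j))))
    where
    open ≤-Reasoning
    rank+corank≡k : rank j + corank j ≡ k
    rank+corank≡k = suc-injective (trans (sym (+-suc (rank j) (corank j))) (rank+corank j))
    k-t≤corank : k ∸ suc t ≤ corank j
    k-t≤corank = begin
      k ∸ suc t                   ≤⟨ ∸-monoʳ-≤ k rank≤1+t ⟩
      k ∸ rank j                  ≡⟨ cong (_∸ rank j) rank+corank≡k ⟨
      rank j + corank j ∸ rank j  ≡⟨ m+n∸m≡n (rank j) (corank j) ⟩
      corank j                    ∎

  rankInQuery-< : ∀ {i j} → r (z i) < r (z j) → suc (rankInQuery r z i j) ≡ rank j
  rankInQuery-< {i} {j} =
    count-except-P Fin._≟_ (λ l → r (z l) <? r (z j)) (Unique.allFin⁺ (suc k)) (∈-allFin i)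

  rankInQuery-≮ : ∀ {i j} → ¬ r (z i) < r (z j) → rankInQuery r z i j ≡ rank j
  rankInQuery-≮ {i} {j} zi≮zj =
    count-except-¬P Fin._≟_ (λ l → r (z l) <? r (z j)) zi≮zj (allFin (suc k))

  -- Ranks count from 0, so the answers of a (k, 1 + t) scale have rank t or 1 + t in Z.
  module Answers {t} (a : Fin (suc k) → Fin (suc k)) (answers : IsAnswers r z (suc t) a) where

    answer-rank : ∀ i → (rank (a i) ≡ t × r (z (a i)) < r (z i))
                      ⊎ (rank (a i) ≡ suc t × r (z i) < r (z (a i)))
    answer-rank i with r (z i) <? r (z (a i))
    ... | yes zi<zai = inj₂ (trans (sym (rankInQuery-< zi<zai)) (cong suc (proj₂ (answers i))) , zi<zai)
    ... | no  zi≮zai = inj₁ ( trans (sym (rankInQuery-≮ zi≮zai)) (proj₂ (answers i))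
                            , ≤∧≢⇒< (≮⇒≥ zi≮zai) (λ e → proj₁ (answers i) (r∘z-injective e)))

    answer-rank-≢ : ∀ i → rank (a i) ≢ rank i
    answer-rank-≢ i e = proj₁ (answers i) (rank-injective e)

    answer²-rank : ∀ i → (rank (a i) ≡ t × rank (a (a i)) ≡ suc t)
                       ⊎ (rank (a i) ≡ suc t × rank (a (a i)) ≡ t)
    answer²-rank i with answer-rank i | answer-rank (a i)
    ... | inj₁ (r₁ , _) | inj₂ (r₂ , _) = inj₁ (r₁ , r₂)
    ... | inj₂ (r₁ , _) | inj₁ (r₂ , _) = inj₂ (r₁ , r₂)
    ... | inj₁ (r₁ , _) | inj₁ (r₂ , _) = contradiction (trans r₂ (sym r₁)) (answer-rank-≢ (a i))
    ... | inj₂ (r₁ , _) | inj₂ (r₂ , _) = contradiction (trans r₂ (sym r₁)) (answer-rank-≢ (a i))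

    private
      t<x⇒x≮1+t : ∀ {x} → t < x → ¬ x < suc t
      t<x⇒x≮1+t t<x x<1+t = <⇒≱ t<x (m<1+n⇒m≤n x<1+t)

    multiplicity-upper : ∀ {j} → rank j ≡ suc t → multiplicity a j ≡ rank j
    multiplicity-upper {j} rj≡1+t = count-cong (λ i → a i Fin.≟ j) (λ l → r (z l) <? r (z j))
      (All.universal (λ i → mk⇔ (to i) (from i)) (allFin (suc k)))
      where
      to : ∀ i → a i ≡ j → r (z i) < r (z j)
      to i refl with answer-rank i
      ... | inj₁ (rai≡t , _) = contradiction (trans (sym rai≡t) rj≡1+t) (≢-sym 1+n≢n)
      ... | inj₂ (_ , i<ai)  = i<ai
      from : ∀ i → r (z i) < r (z j) → a i ≡ j
      from i i<j with answer-rank i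
      ... | inj₂ (rai≡1+t , _)  = rank-injective (trans rai≡1+t (sym rj≡1+t))
      ... | inj₁ (rai≡t , ai<i) = contradiction (subst (rank i <_) rj≡1+t (rank-mono-< i<j))
                                    (t<x⇒x≮1+t (subst (_< rank i) rai≡t (rank-mono-< ai<i)))

    multiplicity-lower : ∀ {j} → rank j ≡ t → multiplicity a j ≡ corank j
    multiplicity-lower {j} rj≡t = count-cong (λ i → a i Fin.≟ j) (λ l → r (z j) <? r (z l))
      (All.universal (λ i → mk⇔ (to i) (from i)) (allFin (suc k)))
      where
      to : ∀ i → a i ≡ j → r (z j) < r (z i)
      to i refl with answer-rank i
      ... | inj₁ (_ , ai<i)    = ai<i
      ... | inj₂ (rai≡1+t , _) = contradiction (trans (sym rj≡t) rai≡1+t) (≢-sym 1+n≢n)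
      from : ∀ i → r (z j) < r (z i) → a i ≡ j
      from i j<i with answer-rank i
      ... | inj₁ (rai≡t , _)      = rank-injective (trans rai≡t (sym rj≡t))
      ... | inj₂ (rai≡1+t , i<ai) = contradiction (subst (rank i <_) rai≡1+t (rank-mono-< i<ai))
                                      (t<x⇒x≮1+t (subst (_< rank i) rj≡t (rank-mono-< j<i)))

    orderedPair-ranks : 2 * suc t ≢ k + 1 →
      rank (proj₁ (orderedPair (suc t) a)) ≡ t × rank (proj₂ (orderedPair (suc t) a)) ≡ suc t
    orderedPair-ranks asymmetric with multiplicity a (a zero) ℕ.≟ suc t | answer²-rank zero
    ... | yes _     | inj₂ (r₁ , r₂) = r₂ , r₁
    ... | no  _     | inj₁ (r₁ , r₂) = r₁ , r₂
    ... | no  m≢1+t | inj₂ (r₁ , _)  = contradiction (trans (multiplicity-upper r₁) r₁) m≢1+t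
    ... | yes m≡1+t | inj₁ (r₁ , _)  = contradiction symmetric asymmetric
      where
      open ≡-Reasoning
      corank≡1+t : corank (a zero) ≡ suc t
      corank≡1+t = trans (sym (multiplicity-lower r₁)) m≡1+t
      symmetric : 2 * suc t ≡ k + 1
      symmetric = begin
        2 * suc t                              ≡⟨ cong (λ s → suc (t + suc s)) (+-identityʳ t) ⟩
        suc (t + suc t)                        ≡⟨ +-suc t (suc t) ⟨
        t + suc (suc t)                        ≡⟨ cong₂ (λ x c → x + suc c) r₁ corank≡1+t ⟨
        rank (a zero) + suc (corank (a zero))  ≡⟨ rank+corank (a zero) ⟩
        suc k                                  ≡⟨ +-comm 1 k ⟩
        k + 1                                  ∎

lemma1 : (n k t : ℕ) → 1 ≤ t → t ≤ k → 2 * t ≢ k + 1 →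
    (z : Fin (suc k) → Fin n) → Injective _≡_ _≡_ z →
    Σ ((Fin (suc k) → Fin (suc k)) → Fin (suc k) × Fin (suc k)) λ f →
      (r : Fin n → ℕ) → Injective _≡_ _≡_ r →
      (a : Fin (suc k) → Fin (suc k)) → IsAnswers r z t a →
        (¬ InS r t (z (proj₁ (f a)))) × (¬ InL r k t (z (proj₁ (f a)))) ×
        (¬ InS r t (z (proj₂ (f a)))) × (¬ InL r k t (z (proj₂ (f a)))) ×
        (r (z (proj₁ (f a))) < r (z (proj₂ (f a))))
lemma1 n k (suc t) (s≤s z≤n) _ asymmetric z z-injective =
  orderedPair (suc t) , λ r r-injective a answers →
  let open Scale r r-injective z z-injective
      open Answers a answers
      rx≡t , ry≡1+t = orderedPair-ranks asymmetric
      x∉S , x∉L = rank-between⇒∉S∪L (≤-reflexive (sym rx≡t)) (≤-trans (≤-reflexive rx≡t) (n≤1+n t))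
      y∉S , y∉L = rank-between⇒∉S∪L (≤-trans (n≤1+n t) (≤-reflexive (sym ry≡1+t))) (≤-reflexive ry≡1+t)
  in x∉S , x∉L , y∉S , y∉L , rank-cancel-< (subst₂ _<_ (sym rx≡t) (sym ry≡1+t) (n<1+n t))
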